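{- Let $\mathfrak{S}_n$ be the set of $n$-permutations $\pi$ such that $\sum_{j=1}^{i}(\pi_j-j)\leq 2$ for every $i\in[n]$ (call such permutations conforming). If $n\geq 5$ and $\pi\in\mathfrak{S}_n$, then $\pi=\alpha\oplus\beta$ where $\beta\in\{1, 21, 231, 312, 321, 3142\}$ and $\alpha$ is a conforming permutation of length $n-|\beta|$.
   Context: For permutations $\alpha,\beta$ of lengths $a,b$, $\alpha\oplus\beta=\alpha_1\cdots\alpha_a(\beta_1+a)\cdots(\beta_b+a)$. $|\beta|$ denotes the length of $\beta$. -}

module Defs where

import Data.Nat as ℕ
open import Data.Nat using (ℕ; _+_; _≤_)
open import Data.Fin using (Fin; toℕ; zero; suc; splitAt; _↑ˡ_; _↑ʳ_; cast)
open import Data.Fin.Permutation using (Permutation′; _⟨$⟩ʳ_)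
open import Data.Sum using (inj₁; inj₂)
open import Data.List using (List; []; _∷_; map; length; allFin)
open import Relation.Binary.PropositionalEquality using (_≡_)

-- Permutations of [n] are bijections of Fin n (values 0-based: π i = π_{i+1} - 1).
-- The quantity Σ_{j=1}^{i} (π_j - j) is unchanged by shifting to 0-based indices/values.

prefixSum : ∀ {n} → (Fin n → ℕ) → ℕ → ℕ
prefixSum {ℕ.zero} f i = 0
prefixSum {ℕ.suc n} f ℕ.zero = 0
prefixSum {ℕ.suc n} f (ℕ.suc i) = f zero + prefixSum (λ j → f (suc j)) i

-- conforming: for every i ∈ [n],  Σ_{j=1}^{i} π_j ≤ Σ_{j=1}^{i} j + 2
-- (equivalently Σ_{j=1}^{i} (π_j - j) ≤ 2, written without integer subtraction)
Conforming : ∀ {n} → Permutation′ n → Set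
Conforming {n} π = ∀ i → 1 ≤ i → i ≤ n →
  prefixSum (λ j → toℕ (π ⟨$⟩ʳ j)) i ≤ prefixSum {n} (λ j → toℕ j) i + 2

⊕fun : ∀ {a b} → (Fin a → Fin a) → (Fin b → Fin b) → Fin (a + b) → Fin (a + b)
⊕fun {a} {b} α β i with splitAt a i
... | inj₁ x = α x ↑ˡ b
... | inj₂ y = a ↑ʳ β y

oneLine : ∀ {k} → Permutation′ k → List ℕ
oneLine {k} β = map (λ j → ℕ.suc (toℕ (β ⟨$⟩ʳ j))) (allFin k)

data AllowedBlock : List ℕ → Set where
  b1    : AllowedBlock (1 ∷ [])
  b21   : AllowedBlock (2 ∷ 1 ∷ [])
  b231  : AllowedBlock (2 ∷ 3 ∷ 1 ∷ [])
  b312  : AllowedBlock (3 ∷ 1 ∷ 2 ∷ [])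
  b321  : AllowedBlock (3 ∷ 2 ∷ 1 ∷ [])
  b3142 : AllowedBlock (3 ∷ 1 ∷ 4 ∷ 2 ∷ [])

-- Write cᵢ = (n - 1) - π(n - 4 + i) (0-based) for the co-values of the last four entries. Since
-- π and the identity have the same total, conformity at position i is equivalent to the suffix
-- inequality Σ_{j ≥ i} π_j + 2 ≥ Σ_{j ≥ i} j; at the last four positions this reads
--   c₃ ≤ 2,  c₃ + c₂ ≤ 3,  c₃ + c₂ + c₁ ≤ 5,  c₃ + c₂ + c₁ + c₀ ≤ 8,
-- and the cᵢ are distinct. A finite case analysis shows that the tail of π is then one of the six
-- blocks, and a permutation that maps a final segment of positions onto itself is a direct sum
-- whose left summand inherits conformity.
module Submission where

open import Defs
open import Data.Nat using (ℕ; zero; suc; _+_; _∸_; _≤_; z≤n; s≤s; s≤s⁻¹)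
open import Data.Nat.Properties
  using (+-comm; +-assoc; +-suc; +-cancelˡ-≤; +-cancelʳ-≡; +-monoˡ-≤; +-monoʳ-≤; m≤m+n; ≤-trans;
         m+[n∸m]≡n; +-0-commutativeMonoid; +-commutativeSemigroup; module ≤-Reasoning)
open import Data.Fin using (Fin; toℕ; cast; splitAt; _↑ˡ_; _↑ʳ_)
open import Data.Fin.Properties
  using (toℕ-injective; toℕ-↑ˡ; toℕ-↑ʳ; ↑ˡ-injective; ↑ʳ-injective; splitAt-↑ˡ; splitAt-↑ʳ;
         splitAt⁻¹-↑ˡ; splitAt⁻¹-↑ʳ; cast-is-id; toℕ<n; toℕ≤n)
open import Data.Fin.Patterns using (0F; 1F; 2F; 3F)
open import Data.Fin.Permutation
  using (Permutation′; permutation; _⟨$⟩ʳ_; _⟨$⟩ˡ_; inverseˡ; inverseʳ; id; transpose; reverse)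
open import Data.Vec using (Vec; []; _∷_; lookup; tabulate)
open import Data.Vec.Properties using (lookup∘tabulate)
open import Data.Sum using (inj₁; inj₂)
open import Data.Product using (Σ; ∃; _×_; _,_; proj₁; proj₂)
open import Function using (_∘_)
open import Relation.Nullary using (contradiction)
open import Relation.Binary.PropositionalEquality
  using (_≡_; _≢_; _≗_; refl; sym; trans; cong; cong₂; subst; subst₂; module ≡-Reasoning)
open import Algebra.Properties.CommutativeMonoid.Sum +-0-commutativeMonoid using (sum; sum-permute)
open import Algebra.Properties.CommutativeSemigroup +-commutativeSemigroup using (interchange)

private variable
  a k n : ℕ

m+n≡o+p⇒m≤o+s⇒p≤n+s : ∀ {m n o p} s → m + n ≡ o + p → m ≤ o + s → p ≤ n + s
m+n≡o+p⇒m≤o+s⇒p≤n+s {m} {n} {o} {p} s eq m≤o+s = +-cancelˡ-≤ o p (n + s) (begin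
  o + p        ≡⟨ sym eq ⟩
  m + n        ≤⟨ +-monoˡ-≤ n m≤o+s ⟩
  o + s + n    ≡⟨ +-assoc o s n ⟩
  o + (s + n)  ≡⟨ cong (o +_) (+-comm s n) ⟩
  o + (n + s)  ∎)
  where open ≤-Reasoning

prefixSum-cong : {f g : Fin n → ℕ} → f ≗ g → ∀ i → prefixSum f i ≡ prefixSum g i
prefixSum-cong {zero}  f≗g i       = refl
prefixSum-cong {suc n} f≗g zero    = refl
prefixSum-cong {suc n} f≗g (suc i) = cong₂ _+_ (f≗g 0F) (prefixSum-cong (f≗g ∘ Fin.suc) i)

prefixSum-↑ˡ : ∀ a (f : Fin (a + k) → ℕ) {i} → i ≤ a → prefixSum f i ≡ prefixSum (f ∘ (_↑ˡ k)) i
prefixSum-↑ˡ {k = zero}  zero    f z≤n = refl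
prefixSum-↑ˡ {k = suc k} zero    f z≤n = refl
prefixSum-↑ˡ             (suc a) f {zero}  i≤a       = refl
prefixSum-↑ˡ             (suc a) f {suc i} (s≤s i≤a) = cong (f 0F +_) (prefixSum-↑ˡ a (f ∘ Fin.suc) i≤a)

-- Σ_{i ≤ j < n} f j, accumulated from the right: for a concrete length this makes the suffix sums of
-- [c₀, c₁, c₂, c₃] compute to 0 + c₃, 0 + c₃ + c₂, ..., which is what the case analysis matches on.
suffixSum : (Fin n → ℕ) → ℕ → ℕ
suffixSum {zero}  f i       = 0
suffixSum {suc n} f zero    = suffixSum (f ∘ Fin.suc) zero + f 0F
suffixSum {suc n} f (suc i) = suffixSum (f ∘ Fin.suc) i

suffixSum-cong : {f g : Fin n → ℕ} → f ≗ g → ∀ i → suffixSum f i ≡ suffixSum g i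
suffixSum-cong {zero}  f≗g i       = refl
suffixSum-cong {suc n} f≗g zero    = cong₂ _+_ (suffixSum-cong (f≗g ∘ Fin.suc) zero) (f≗g 0F)
suffixSum-cong {suc n} f≗g (suc i) = suffixSum-cong (f≗g ∘ Fin.suc) i

suffixSum-+ : ∀ (f g : Fin n → ℕ) i →
  suffixSum (λ j → f j + g j) i ≡ suffixSum f i + suffixSum g i
suffixSum-+ {zero}  f g i       = refl
suffixSum-+ {suc n} f g zero    =
  trans (cong (_+ (f 0F + g 0F)) (suffixSum-+ (f ∘ Fin.suc) (g ∘ Fin.suc) zero))
        (interchange (suffixSum (f ∘ Fin.suc) zero) (suffixSum (g ∘ Fin.suc) zero) (f 0F) (g 0F))
suffixSum-+ {suc n} f g (suc i) = suffixSum-+ (f ∘ Fin.suc) (g ∘ Fin.suc) i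

suffixSum-↑ʳ : ∀ a (f : Fin (a + k) → ℕ) i → suffixSum f (a + i) ≡ suffixSum (f ∘ (a ↑ʳ_)) i
suffixSum-↑ʳ zero    f i = refl
suffixSum-↑ʳ (suc a) f i = suffixSum-↑ʳ a (f ∘ Fin.suc) i

suffixSum-zero : ∀ (f : Fin n → ℕ) → suffixSum f 0 ≡ sum f
suffixSum-zero {zero}  f = refl
suffixSum-zero {suc n} f = trans (+-comm _ (f 0F)) (cong (f 0F +_) (suffixSum-zero (f ∘ Fin.suc)))

prefixSum+suffixSum : ∀ (f : Fin n → ℕ) i → prefixSum f i + suffixSum f i ≡ sum f
prefixSum+suffixSum {zero}  f i       = refl
prefixSum+suffixSum {suc n} f zero    = suffixSum-zero f
prefixSum+suffixSum {suc n} f (suc i) =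
  trans (+-assoc (f 0F) _ _) (cong (f 0F +_) (prefixSum+suffixSum (f ∘ Fin.suc) i))

Conforming-suffix : ∀ {n} (π : Permutation′ n) → Conforming π → ∀ {i} → 1 ≤ i → i ≤ n →
  suffixSum (toℕ {n}) i ≤ suffixSum (toℕ ∘ (π ⟨$⟩ʳ_)) i + 2
Conforming-suffix {n} π conf {i} 1≤i i≤n =
  m+n≡o+p⇒m≤o+s⇒p≤n+s 2 same-total (conf i 1≤i i≤n)
  where
  same-total : prefixSum (toℕ ∘ (π ⟨$⟩ʳ_)) i + suffixSum (toℕ ∘ (π ⟨$⟩ʳ_)) i
             ≡ prefixSum (toℕ {n}) i + suffixSum (toℕ {n}) i
  same-total = trans (prefixSum+suffixSum (toℕ ∘ (π ⟨$⟩ʳ_)) i)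
               (trans (sym (sum-permute (toℕ {n}) π)) (sym (prefixSum+suffixSum (toℕ {n}) i)))

Conforming-↑ˡ : (π : Permutation′ (a + k)) (α : Permutation′ a) →
  (∀ i → π ⟨$⟩ʳ (i ↑ˡ k) ≡ (α ⟨$⟩ʳ i) ↑ˡ k) → Conforming π → Conforming α
Conforming-↑ˡ {a} {k} π α π-↑ˡ conf i 1≤i i≤a =
  subst₂ (λ x y → x ≤ y + 2) values positions (conf i 1≤i (≤-trans i≤a (m≤m+n a k)))
  where
  values : prefixSum (toℕ ∘ (π ⟨$⟩ʳ_)) i ≡ prefixSum (toℕ ∘ (α ⟨$⟩ʳ_)) i
  values = trans (prefixSum-↑ˡ a _ i≤a)
                 (prefixSum-cong (λ j → trans (cong toℕ (π-↑ˡ j)) (toℕ-↑ˡ (α ⟨$⟩ʳ j) k)) i)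
  positions : prefixSum {a + k} toℕ i ≡ prefixSum {a} toℕ i
  positions = trans (prefixSum-↑ˡ a toℕ i≤a)
                    (prefixSum-cong {a} {f = toℕ ∘ (_↑ˡ k)} {g = toℕ} (λ j → toℕ-↑ˡ j k) i)

↑ˡ≢↑ʳ : (i : Fin a) (j : Fin k) → i ↑ˡ k ≢ a ↑ʳ j
↑ˡ≢↑ʳ {a} {k} i j eq with trans (sym (splitAt-↑ˡ a i k)) (trans (cong (splitAt a) eq) (splitAt-↑ʳ a k j))
... | ()

↑ˡ-preserved : (f g : Fin (a + k) → Fin (a + k)) {h : Fin k → Fin k} →
  (∀ x → g (f x) ≡ x) → (∀ j → g (a ↑ʳ j) ≡ a ↑ʳ h j) →
  ∀ i → ∃ λ x → f (i ↑ˡ k) ≡ x ↑ˡ k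
↑ˡ-preserved {a} {k} f g {h} g∘f g-↑ʳ i with splitAt a (f (i ↑ˡ k)) in eq
... | inj₁ x = x , sym (splitAt⁻¹-↑ˡ eq)
... | inj₂ y = contradiction (begin
  i ↑ˡ k          ≡⟨ sym (g∘f (i ↑ˡ k)) ⟩
  g (f (i ↑ˡ k))  ≡⟨ cong g (sym (splitAt⁻¹-↑ʳ eq)) ⟩
  g (a ↑ʳ y)      ≡⟨ g-↑ʳ y ⟩
  a ↑ʳ h y        ∎) (↑ˡ≢↑ʳ i (h y))
  where open ≡-Reasoning

module LeftSummand (π : Permutation′ (a + k)) (β : Permutation′ k)
                   (π-↑ʳ : ∀ j → π ⟨$⟩ʳ (a ↑ʳ j) ≡ a ↑ʳ (β ⟨$⟩ʳ j)) where

  π⁻¹-↑ʳ : ∀ j → π ⟨$⟩ˡ (a ↑ʳ j) ≡ a ↑ʳ (β ⟨$⟩ˡ j)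
  π⁻¹-↑ʳ j = begin
    π ⟨$⟩ˡ (a ↑ʳ j)                     ≡⟨ cong (λ y → π ⟨$⟩ˡ (a ↑ʳ y)) (sym (inverseʳ β)) ⟩
    π ⟨$⟩ˡ (a ↑ʳ (β ⟨$⟩ʳ (β ⟨$⟩ˡ j)))   ≡⟨ cong (π ⟨$⟩ˡ_) (sym (π-↑ʳ (β ⟨$⟩ˡ j))) ⟩
    π ⟨$⟩ˡ (π ⟨$⟩ʳ (a ↑ʳ (β ⟨$⟩ˡ j)))   ≡⟨ inverseˡ π ⟩
    a ↑ʳ (β ⟨$⟩ˡ j)                     ∎
    where open ≡-Reasoning

  to-↑ˡ : ∀ i → ∃ λ x → π ⟨$⟩ʳ (i ↑ˡ k) ≡ x ↑ˡ k
  to-↑ˡ = ↑ˡ-preserved (π ⟨$⟩ʳ_) (π ⟨$⟩ˡ_) (λ _ → inverseˡ π) π⁻¹-↑ʳ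

  from-↑ˡ : ∀ i → ∃ λ x → π ⟨$⟩ˡ (i ↑ˡ k) ≡ x ↑ˡ k
  from-↑ˡ = ↑ˡ-preserved (π ⟨$⟩ˡ_) (π ⟨$⟩ʳ_) (λ _ → inverseʳ π) π-↑ʳ

  α : Permutation′ a
  α = permutation (proj₁ ∘ to-↑ˡ) (proj₁ ∘ from-↑ˡ)
    (λ i → ↑ˡ-injective k _ _ (trans (sym (proj₂ (to-↑ˡ _)))
                               (trans (cong (π ⟨$⟩ʳ_) (sym (proj₂ (from-↑ˡ i)))) (inverseʳ π))))
    (λ i → ↑ˡ-injective k _ _ (trans (sym (proj₂ (from-↑ˡ _)))
                               (trans (cong (π ⟨$⟩ˡ_) (sym (proj₂ (to-↑ˡ i)))) (inverseˡ π))))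

  π≗α⊕β : ∀ i → π ⟨$⟩ʳ i ≡ ⊕fun (α ⟨$⟩ʳ_) (β ⟨$⟩ʳ_) i
  π≗α⊕β i with splitAt a i in eq
  ... | inj₁ x = trans (cong (π ⟨$⟩ʳ_) (sym (splitAt⁻¹-↑ˡ eq))) (proj₂ (to-↑ˡ x))
  ... | inj₂ y = trans (cong (π ⟨$⟩ʳ_) (sym (splitAt⁻¹-↑ʳ eq))) (π-↑ʳ y)

AllowedDecomposition : Permutation′ n → Set
AllowedDecomposition {n} π = Σ ℕ λ a → Σ ℕ λ k → Σ (a + k ≡ n) λ eq →
  Σ (Permutation′ a) λ α → Σ (Permutation′ k) λ β →
    AllowedBlock (oneLine β) × Conforming α ×
    ((i : Fin (a + k)) → π ⟨$⟩ʳ cast eq i ≡ cast eq (⊕fun (α ⟨$⟩ʳ_) (β ⟨$⟩ʳ_) i))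

EndsWith : (π : Permutation′ n) (a : ℕ) (β : Permutation′ k) → Set
EndsWith {n} {k} π a β =
  ∀ (j : Fin k) (p : Fin n) → toℕ p ≡ a + toℕ j → toℕ (π ⟨$⟩ʳ p) ≡ a + toℕ (β ⟨$⟩ʳ j)

EndsWith⇒AllowedDecomposition : ∀ a k (eq : a + k ≡ n) (π : Permutation′ n) (β : Permutation′ k) →
  AllowedBlock (oneLine β) → Conforming π → EndsWith π a β → AllowedDecomposition π
EndsWith⇒AllowedDecomposition a k refl π β allowed conf ends =
  a , k , refl , α , β , allowed , Conforming-↑ˡ π α (proj₂ ∘ to-↑ˡ) conf , decomposition
  where
  π-↑ʳ : ∀ j → π ⟨$⟩ʳ (a ↑ʳ j) ≡ a ↑ʳ (β ⟨$⟩ʳ j)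
  π-↑ʳ j = toℕ-injective (trans (ends j (a ↑ʳ j) (toℕ-↑ʳ a j)) (sym (toℕ-↑ʳ a (β ⟨$⟩ʳ j))))

  open LeftSummand π β π-↑ʳ

  decomposition : ∀ i → π ⟨$⟩ʳ cast refl i ≡ cast refl (⊕fun (α ⟨$⟩ʳ_) (β ⟨$⟩ʳ_) i)
  decomposition i = trans (cong (π ⟨$⟩ʳ_) (cast-is-id refl i))
                          (trans (π≗α⊕β i) (sym (cast-is-id refl _)))

β₁ : Permutation′ 1
β₁ = id

β₂₁ : Permutation′ 2
β₂₁ = transpose 0F 1F

β₃₂₁ : Permutation′ 3
β₃₂₁ = reverse

rotate : Fin 3 → Fin 3
rotate 0F = 1F
rotate 1F = 2F
rotate 2F = 0F

rotate⁻¹ : Fin 3 → Fin 3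
rotate⁻¹ 0F = 2F
rotate⁻¹ 1F = 0F
rotate⁻¹ 2F = 1F

β₂₃₁ : Permutation′ 3
β₂₃₁ = permutation rotate rotate⁻¹ (λ { 0F → refl ; 1F → refl ; 2F → refl })
                                   (λ { 0F → refl ; 1F → refl ; 2F → refl })

β₃₁₂ : Permutation′ 3
β₃₁₂ = permutation rotate⁻¹ rotate (λ { 0F → refl ; 1F → refl ; 2F → refl })
                                   (λ { 0F → refl ; 1F → refl ; 2F → refl })

to₃₁₄₂ : Fin 4 → Fin 4
to₃₁₄₂ 0F = 2F
to₃₁₄₂ 1F = 0F
to₃₁₄₂ 2F = 3F
to₃₁₄₂ 3F = 1F

from₃₁₄₂ : Fin 4 → Fin 4
from₃₁₄₂ 0F = 1F
from₃₁₄₂ 1F = 3F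
from₃₁₄₂ 2F = 0F
from₃₁₄₂ 3F = 2F

β₃₁₄₂ : Permutation′ 4
β₃₁₄₂ = permutation to₃₁₄₂ from₃₁₄₂ (λ { 0F → refl ; 1F → refl ; 2F → refl ; 3F → refl })
                                    (λ { 0F → refl ; 1F → refl ; 2F → refl ; 3F → refl })

-- Indexed by the co-values [c₀, c₁, c₂, c₃]; a final block β of size k has c_{4-k+j} = k - 1 - β_j.
data TailShape : Vec ℕ 4 → Set where
  ends-1    : ∀ {c₀ c₁ c₂} → TailShape (c₀ ∷ c₁ ∷ c₂ ∷ 0 ∷ [])
  ends-21   : ∀ {c₀ c₁}    → TailShape (c₀ ∷ c₁ ∷ 0 ∷ 1 ∷ [])
  ends-312  : ∀ {c₀}       → TailShape (c₀ ∷ 0 ∷ 2 ∷ 1 ∷ [])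
  ends-231  : ∀ {c₀}       → TailShape (c₀ ∷ 1 ∷ 0 ∷ 2 ∷ [])
  ends-321  : ∀ {c₀}       → TailShape (c₀ ∷ 0 ∷ 1 ∷ 2 ∷ [])
  ends-3142 :                TailShape (1 ∷ 3 ∷ 0 ∷ 2 ∷ [])

tailShape : ∀ {c₀ c₁ c₂ c₃} → let c = c₀ ∷ c₁ ∷ c₂ ∷ c₃ ∷ [] in
  (∀ {i j} → lookup c i ≡ lookup c j → i ≡ j) →
  0 + c₃ ≤ 2 → 0 + c₃ + c₂ ≤ 3 → 0 + c₃ + c₂ + c₁ ≤ 5 → 0 + c₃ + c₂ + c₁ + c₀ ≤ 8 →
  TailShape c
tailShape {c₃ = 0}                     _   _ _ _ _ = ends-1
tailShape {c₂ = 0} {1}                 _   _ _ _ _ = ends-21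
tailShape {c₂ = 1} {1}                 inj _ _ _ _ = contradiction (inj {2F} {3F} refl) λ ()
tailShape {c₁ = 0} {2} {1}             _   _ _ _ _ = ends-312
tailShape {c₁ = 1} {2} {1}             inj _ _ _ _ = contradiction (inj {1F} {3F} refl) λ ()
tailShape {c₁ = 2} {2} {1}             inj _ _ _ _ = contradiction (inj {1F} {2F} refl) λ ()
tailShape {c₁ = suc (suc (suc _))} {2} {1} _ _ _ (s≤s (s≤s (s≤s (s≤s (s≤s ()))))) _
tailShape {c₂ = suc (suc (suc _))} {1}     _ _ (s≤s (s≤s (s≤s ()))) _ _
tailShape {c₁ = 0} {0} {2}             inj _ _ _ _ = contradiction (inj {1F} {2F} refl) λ ()
tailShape {c₁ = 1} {0} {2}             _   _ _ _ _ = ends-231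
tailShape {c₁ = 2} {0} {2}             inj _ _ _ _ = contradiction (inj {1F} {3F} refl) λ ()
tailShape {0} {3} {0} {2}              inj _ _ _ _ = contradiction (inj {0F} {2F} refl) λ ()
tailShape {1} {3} {0} {2}              _   _ _ _ _ = ends-3142
tailShape {2} {3} {0} {2}              inj _ _ _ _ = contradiction (inj {0F} {3F} refl) λ ()
tailShape {3} {3} {0} {2}              inj _ _ _ _ = contradiction (inj {0F} {1F} refl) λ ()
tailShape {suc (suc (suc (suc _)))} {3} {0} {2} _ _ _ _ (s≤s (s≤s (s≤s (s≤s (s≤s (s≤s (s≤s (s≤s ()))))))))
tailShape {c₁ = suc (suc (suc (suc _)))} {0} {2} _ _ _ (s≤s (s≤s (s≤s (s≤s (s≤s ()))))) _
tailShape {c₁ = 0} {1} {2}             _   _ _ _ _ = ends-321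
tailShape {c₁ = 1} {1} {2}             inj _ _ _ _ = contradiction (inj {1F} {2F} refl) λ ()
tailShape {c₁ = 2} {1} {2}             inj _ _ _ _ = contradiction (inj {1F} {3F} refl) λ ()
tailShape {c₁ = suc (suc (suc _))} {1} {2} _ _ _ (s≤s (s≤s (s≤s (s≤s (s≤s ()))))) _
tailShape {c₂ = suc (suc _)} {2}           _ _ (s≤s (s≤s (s≤s ()))) _ _
tailShape {c₃ = suc (suc (suc _))}         _ (s≤s (s≤s ())) _ _ _

module Tail (a : ℕ) (1≤a : 1 ≤ a) (π : Permutation′ (a + 4)) (conf : Conforming π) where

  value : Fin 4 → ℕ
  value j = toℕ (π ⟨$⟩ʳ (a ↑ʳ j))

  coValue : Fin 4 → ℕ
  coValue j = a + 3 ∸ value j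

  value+coValue : ∀ j → value j + coValue j ≡ a + 3
  value+coValue j = m+[n∸m]≡n (s≤s⁻¹ (subst (suc (value j) ≤_) (+-suc a 3) (toℕ<n (π ⟨$⟩ʳ (a ↑ʳ j)))))

  position : Fin 4 → ℕ
  position j = toℕ (a ↑ʳ j)

  offset : Fin 4 → ℕ
  offset j = 3 ∸ toℕ j

  position+offset : ∀ j → position j + offset j ≡ a + 3
  position+offset j = trans (cong (_+ (3 ∸ toℕ j)) (toℕ-↑ʳ a j))
                      (trans (+-assoc a (toℕ j) _) (cong (a +_) (m+[n∸m]≡n (s≤s⁻¹ (toℕ<n j)))))

  coValue-bound : ∀ (i : Fin 4) → suffixSum coValue (toℕ i) ≤ suffixSum offset (toℕ i) + 2
  coValue-bound i = m+n≡o+p⇒m≤o+s⇒p≤n+s 2 sums-agree tail-conforming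
    where
    tail-conforming : suffixSum position (toℕ i) ≤ suffixSum value (toℕ i) + 2
    tail-conforming = subst₂ (λ x y → x ≤ y + 2)
      (suffixSum-↑ʳ a (toℕ {a + 4}) (toℕ i)) (suffixSum-↑ʳ a (toℕ ∘ (π ⟨$⟩ʳ_)) (toℕ i))
      (Conforming-suffix π conf (≤-trans 1≤a (m≤m+n a _)) (+-monoʳ-≤ a (toℕ≤n i)))

    sums-agree : suffixSum position (toℕ i) + suffixSum offset (toℕ i)
               ≡ suffixSum value (toℕ i) + suffixSum coValue (toℕ i)
    sums-agree = trans (sym (suffixSum-+ position offset (toℕ i)))
                 (trans (suffixSum-cong (λ j → trans (position+offset j) (sym (value+coValue j))) (toℕ i))
                        (suffixSum-+ value coValue (toℕ i)))

  coValue-injective : ∀ {i j} → coValue i ≡ coValue j → i ≡ j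
  coValue-injective {i} {j} eq = ↑ʳ-injective a i j (begin
    a ↑ʳ i                         ≡⟨ sym (inverseˡ π) ⟩
    π ⟨$⟩ˡ (π ⟨$⟩ʳ (a ↑ʳ i))       ≡⟨ cong (π ⟨$⟩ˡ_) (toℕ-injective same-value) ⟩
    π ⟨$⟩ˡ (π ⟨$⟩ʳ (a ↑ʳ j))       ≡⟨ inverseˡ π ⟩
    a ↑ʳ j                         ∎)
    where
    open ≡-Reasoning
    same-value : value i ≡ value j
    same-value = +-cancelʳ-≡ (coValue i) (value i) (value j)
      (trans (value+coValue i) (sym (trans (cong (value j +_) eq) (value+coValue j))))

  endsWith-entry : ∀ m {i x y c} → value i + c ≡ a + 3 → c + (m + y) ≡ 3 → m + x ≡ toℕ i →
    ∀ (p : Fin (a + 4)) → toℕ p ≡ a + m + x → toℕ (π ⟨$⟩ʳ p) ≡ a + m + y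
  endsWith-entry m {i} {x} {y} {c} value+c c+m+y≡3 m+x≡i p p≡a+m+x = begin
    toℕ (π ⟨$⟩ʳ p)       ≡⟨ cong (toℕ ∘ (π ⟨$⟩ʳ_)) p≡a↑ʳi ⟩
    value i              ≡⟨ +-cancelʳ-≡ c _ _ value+c≡ ⟩
    a + (m + y)          ≡⟨ sym (+-assoc a m y) ⟩
    a + m + y            ∎
    where
    open ≡-Reasoning
    p≡a↑ʳi : p ≡ a ↑ʳ i
    p≡a↑ʳi = toℕ-injective (trans p≡a+m+x
      (trans (+-assoc a m x) (trans (cong (a +_) m+x≡i) (sym (toℕ-↑ʳ a i)))))
    value+c≡ : value i + c ≡ a + (m + y) + c
    value+c≡ = trans value+c (trans (cong (a +_) (sym (trans (+-comm (m + y) c) c+m+y≡3)))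
                                   (sym (+-assoc a (m + y) c)))

  TailShape⇒AllowedDecomposition : ∀ {cs} → (∀ i → value i + lookup cs i ≡ a + 3) →
    TailShape cs → AllowedDecomposition π
  TailShape⇒AllowedDecomposition v+c ends-1 =
    EndsWith⇒AllowedDecomposition (a + 3) 1 (+-assoc a 3 1) π β₁ b1 conf
      λ { 0F → endsWith-entry 3 (v+c 3F) refl refl }
  TailShape⇒AllowedDecomposition v+c ends-21 =
    EndsWith⇒AllowedDecomposition (a + 2) 2 (+-assoc a 2 2) π β₂₁ b21 conf
      λ { 0F → endsWith-entry 2 (v+c 2F) refl refl
        ; 1F → endsWith-entry 2 (v+c 3F) refl refl }
  TailShape⇒AllowedDecomposition v+c ends-312 =
    EndsWith⇒AllowedDecomposition (a + 1) 3 (+-assoc a 1 3) π β₃₁₂ b312 conf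
      λ { 0F → endsWith-entry 1 (v+c 1F) refl refl
        ; 1F → endsWith-entry 1 (v+c 2F) refl refl
        ; 2F → endsWith-entry 1 (v+c 3F) refl refl }
  TailShape⇒AllowedDecomposition v+c ends-231 =
    EndsWith⇒AllowedDecomposition (a + 1) 3 (+-assoc a 1 3) π β₂₃₁ b231 conf
      λ { 0F → endsWith-entry 1 (v+c 1F) refl refl
        ; 1F → endsWith-entry 1 (v+c 2F) refl refl
        ; 2F → endsWith-entry 1 (v+c 3F) refl refl }
  TailShape⇒AllowedDecomposition v+c ends-321 =
    EndsWith⇒AllowedDecomposition (a + 1) 3 (+-assoc a 1 3) π β₃₂₁ b321 conf
      λ { 0F → endsWith-entry 1 (v+c 1F) refl refl
        ; 1F → endsWith-entry 1 (v+c 2F) refl refl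
        ; 2F → endsWith-entry 1 (v+c 3F) refl refl }
  TailShape⇒AllowedDecomposition v+c ends-3142 =
    EndsWith⇒AllowedDecomposition (a + 0) 4 (+-assoc a 0 4) π β₃₁₄₂ b3142 conf
      λ { 0F → endsWith-entry 0 (v+c 0F) refl refl
        ; 1F → endsWith-entry 0 (v+c 1F) refl refl
        ; 2F → endsWith-entry 0 (v+c 2F) refl refl
        ; 3F → endsWith-entry 0 (v+c 3F) refl refl }

  allowedDecomposition : AllowedDecomposition π
  allowedDecomposition = TailShape⇒AllowedDecomposition
    (λ i → trans (cong (value i +_) (lookup∘tabulate coValue i)) (value+coValue i))
    (tailShape (λ {i} {j} eq → coValue-injective
                  (trans (sym (lookup∘tabulate coValue i)) (trans eq (lookup∘tabulate coValue j))))
               (coValue-bound 3F) (coValue-bound 2F) (coValue-bound 1F) (coValue-bound 0F))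

Conforming⇒AllowedDecomposition : 1 ≤ a → a + 4 ≡ n → (π : Permutation′ n) → Conforming π →
  AllowedDecomposition π
Conforming⇒AllowedDecomposition {a} 1≤a refl π conf = Tail.allowedDecomposition a 1≤a π conf

mainTheorem7 : (n : ℕ) → 5 ≤ n → (π : Permutation′ n) → Conforming π →
    Σ ℕ λ a → Σ ℕ λ k → Σ (a + k ≡ n) λ eq →
      Σ (Permutation′ a) λ α → Σ (Permutation′ k) λ β →
        AllowedBlock (oneLine β) × Conforming α ×
        ((i : Fin (a + k)) →
          π ⟨$⟩ʳ cast eq i ≡ cast eq (⊕fun (α ⟨$⟩ʳ_) (β ⟨$⟩ʳ_) i))
mainTheorem7 (suc (suc (suc (suc n)))) (s≤s (s≤s (s≤s (s≤s 1≤n)))) =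
  Conforming⇒AllowedDecomposition 1≤n (+-comm n 4)
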